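{- Let $G$ be a finite $p$-group and let $g\in G$ be an element of order $p^r$, $r\in\mathbb{N}$, such that $\pi(g)>0$ or $\mathrm{o}(g)>2$. Then every nonzero Laplacian eigenvalue of $\Gamma(g)$ is of the form $\mathrm{o}(g_1)-p^{r-1}$ for some $g_1\in U(g)$ or of the form $|\widehat{U}(g_2)|+\mathrm{o}(g_2)-p^{r-1}$ for some $g_2\in U(g)$.
   Context: $p$ is a prime; a $p$-group is a group of order at least two in which every element has order a power of $p$. The power graph $\mathcal{G}(G)$ has vertex set $G$, distinct $u,v$ adjacent iff one is a positive power of the other. $\mathrm{o}(g)$ is the order of $g$, $[g]=\{h\in G:\langle h\rangle=\langle g\rangle\}$. $U(g)=\{h\in G: g\in\langle h\rangle\}$, $\widehat{U}(g)=U(g)\setminus[g]$, and $\Gamma(g)$ is the subgraph of $\mathcal{G}(G)$ induced by $U(g)$. For $g,h\in G$, $[h]$ is a primitive class of $g$ if $[g]=[h^p]$ and $h\ne e$; $\pi(g)$ is the number of distinct primitive classes of $g$. Laplacian eigenvalues are eigenvalues of $L=D-A$. -}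

module Defs where

open import Level using (Level)
open import Data.Nat using (ℕ; zero; suc; _^_; _≤_; _<_)
open import Data.Nat.Primality using (Prime)
open import Data.Fin using (Fin; toℕ) renaming (_≟_ to _≟F_)
open import Data.Bool using (Bool; true; false; _∧_; _∨_; not; T; if_then_else_)
open import Data.Product using (Σ; ∃; _×_; _,_)
open import Data.List using (List; []; _∷_; upTo; allFin; filter; length)
import Data.Bool.ListAction as BL
import Data.Nat
open import Relation.Nullary using (¬_; does)
open import Relation.Binary.PropositionalEquality using (_≡_)
open import Algebra.Bundles using (CommutativeRing)

-- Finite groups: a group whose underlying set is Fin n (every finite
-- group is isomorphic to one of these).

record FinGroup : Set where
  field
    card  : ℕ
    _·_   : Fin card → Fin card → Fin card
    e     : Fin card
    inv   : Fin card → Fin card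
    assoc : ∀ x y z → (x · y) · z ≡ x · (y · z)
    idˡ   : ∀ x → e · x ≡ x
    idʳ   : ∀ x → x · e ≡ x
    invˡ  : ∀ x → inv x · x ≡ e
    invʳ  : ∀ x → x · inv x ≡ e

module _ (G : FinGroup) where
  open FinGroup G

  pow : Fin card → ℕ → Fin card
  pow g zero    = e
  pow g (suc k) = g · pow g k

  IsOrder : Fin card → ℕ → Set
  IsOrder g k = 1 ≤ k × pow g k ≡ e × (∀ j → 1 ≤ j → j < k → ¬ pow g j ≡ e)

  IsPGroup : ℕ → Set
  IsPGroup p = 2 ≤ card × (∀ g → ∃ λ m → IsOrder g (p ^ m))

  -- Boolean test: g ∈ ⟨h⟩, i.e. g = h^k for some k.  Since o(h) ≤ |G|,
  -- it suffices to test 0 ≤ k ≤ |G|.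
  inCyc : Fin card → Fin card → Bool
  inCyc g h = BL.any (λ k → does (pow h k ≟F g)) (upTo (suc card))

  sameCyc : Fin card → Fin card → Bool
  sameCyc h g = inCyc h g ∧ inCyc g h

  inU : Fin card → Fin card → Bool
  inU g h = inCyc g h

  inUhat : Fin card → Fin card → Bool
  inUhat g h = inU g h ∧ not (sameCyc h g)

  count : (Fin card → Bool) → ℕ
  count P = length (filter (λ x → T? (P x)) (allFin card))
    where
    open import Relation.Nullary.Decidable using () renaming (T? to T?′)
    T? : (b : Bool) → Relation.Nullary.Dec (T b)
    T? = T?′

  Uhat-size : Fin card → ℕ
  Uhat-size g = count (inUhat g)

  -- power graph adjacency: u ≠ v and one is a positive power of the other
  -- (positive exponents 1 ≤ k ≤ |G| suffice, as o(v) ≤ |G|).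
  posPow : Fin card → Fin card → Bool
  posPow u v = BL.any (λ k → does (pow v (suc k) ≟F u)) (upTo card)

  adj : Fin card → Fin card → Bool
  adj u v = not (does (u ≟F v)) ∧ (posPow u v ∨ posPow v u)

  primCl : ℕ → Fin card → Fin card → Bool
  primCl p g h = sameCyc (pow h p) g ∧ not (does (h ≟F e))

  minRep : Fin card → Bool
  minRep h = BL.all (λ h′ → not (does (Data.Nat._<?_ (toℕ h′) (toℕ h))) ∨ not (sameCyc h′ h))
                   (allFin card)

  πcl : ℕ → Fin card → ℕ
  πcl p g = count (λ h → primCl p g h ∧ minRep h)

-- Laplacian eigenvalues of Γ(g), over a commutative ring R (taken below
-- to be an integral domain of characteristic 0, e.g. ℂ or ℝ).

module _ {c ℓ : Level} (R : CommutativeRing c ℓ) where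
  open CommutativeRing R

  ℕ→R : ℕ → Carrier
  ℕ→R zero    = 0#
  ℕ→R (suc n) = 1# + ℕ→R n

  sumR : ∀ {n} → (Fin n → Carrier) → Carrier
  sumR {zero}  f = 0#
  sumR {suc n} f = f Fin.zero + sumR (λ i → f (Fin.suc i))
    where import Data.Fin as Fin

  IsDomainChar0 : Set (c Level.⊔ ℓ)
  IsDomainChar0 = (∀ x y → x * y ≈ 0# → (x ≈ 0#) Data.Sum.⊎ (y ≈ 0#))
                × (∀ m → ¬ (ℕ→R (suc m) ≈ 0#))
    where import Data.Sum

  module _ (G : FinGroup) where
    open FinGroup G using (card)

    -- λ is a Laplacian eigenvalue of Γ(g) (the subgraph of the power graph
    -- induced by U(g)): there is a vector v indexed by U(g) (encoded as a
    -- vector on G vanishing off U(g)), nonzero, with L v = λ v, where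
    -- (L v)(u) = deg(u) v(u) - Σ_{w ∈ U(g), w ~ u} v(w).
    IsLapEigenvalueΓ : Fin card → Carrier → Set (c Level.⊔ ℓ)
    IsLapEigenvalueΓ g λ′ =
      Σ (Fin card → Carrier) λ v →
        (∀ u → T (not (inU G g u)) → v u ≈ 0#)
      × (∃ λ u → T (inU G g u) × ¬ (v u ≈ 0#))
      × (∀ u → T (inU G g u) →
           ℕ→R (count G (λ w → inU G g w ∧ adj G u w)) * v u
             - sumR (λ w → if inU G g w ∧ adj G u w then v w else 0#)
           ≈ λ′ * v u)

module Submission where

-- Let v be an eigenvector of the Laplacian of Γ(h), o(h) = p^{s+1}, with eigenvalue μ.  Summing the
-- eigenvalue equation over all vertices gives μ · Σ v = 0, so μ = 0 or Σ v = 0.  Every vertex of [h]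
-- is adjacent to all other vertices of Γ(h), so when Σ v = 0 the equation at c ∈ [h] reads
-- (μ − |U(h)|) v(c) = 0: either μ = |U(h)| = |Û(h)| + o(h) − p^s, or v vanishes on [h].  In the
-- latter case v(u) ≠ 0 for some u ∈ U(h) outside [h], so ⟨h⟩ ⊊ ⟨u⟩ and there is h′ ∈ ⟨u⟩ with
-- h ∈ ⟨h′⟩ and o(h′) = p^{s+2}.  In Γ(h) a vertex d ∈ U(h′) is adjacent to all of [h] and otherwise
-- only to vertices of U(h′), so v restricted to U(h′) is an eigenvector of Γ(h′) with eigenvalue
-- μ − |[h]| = μ − (p^{s+1} − p^s).  Induction up the chain of cyclic subgroups gives the claim.

open import Defs
open import Level using (Level)
open import Data.Nat using (ℕ; zero; suc; _<_; _^_)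
open import Data.Fin using (Fin; zero; suc; toℕ) renaming (_≟_ to _≟ᶠ_)
open import Data.Bool using (Bool; true; false; T; _∧_; _∨_; not; if_then_else_)
open import Data.Bool.Properties using (T-∧; T-∨; T-not-≡; ∨-comm)
open import Data.Product using (∃; _×_; _,_; proj₁; proj₂)
open import Data.Sum as ⊎ using (_⊎_; inj₁; inj₂)
open import Data.Empty using (⊥-elim)
open import Function using (_∘_; case_of_; Equivalence)
open import Relation.Nullary using (¬_; Dec; does; yes; no)
import Relation.Binary.PropositionalEquality as ≡
open ≡ using (_≡_; _≢_)
open import Algebra.Bundles using (CommutativeRing)

T-does⇒ : ∀ {a} {A : Set a} (d : Dec A) → T (does d) → A
T-does⇒ (yes a) _ = a

⇒T-does : ∀ {a} {A : Set a} (d : Dec A) → A → T (does d)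
⇒T-does (yes _) _ = _
⇒T-does (no ¬a) a = ¬a a

T-not-does⇒ : ∀ {a} {A : Set a} (d : Dec A) → T (not (does d)) → ¬ A
T-not-does⇒ (no ¬a) _ = ¬a

⇒T-not-does : ∀ {a} {A : Set a} (d : Dec A) → ¬ A → T (not (does d))
⇒T-not-does (yes a) ¬a = ¬a a
⇒T-not-does (no _)  _  = _

∀⊎⇒⊎∀ : ∀ {a b n} {A : Set a} {B : Fin n → Set b} → (∀ i → A ⊎ B i) → A ⊎ (∀ i → B i)
∀⊎⇒⊎∀ {n = zero}  f = inj₂ λ ()
∀⊎⇒⊎∀ {n = suc n} f with f zero | ∀⊎⇒⊎∀ (f ∘ suc)
... | inj₁ a  | _        = inj₁ a
... | inj₂ _  | inj₁ a   = inj₁ a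
... | inj₂ b₀ | inj₂ bₛ  = inj₂ λ { zero → b₀ ; (suc i) → bₛ i }

T-ext : ∀ {a b} → (T a → T b) → (T b → T a) → a ≡ b
T-ext {false} {false} _ _ = ≡.refl
T-ext {false} {true}  _ b⇒a = ⊥-elim (b⇒a _)
T-ext {true}  {false} a⇒b _ = ⊥-elim (a⇒b _)
T-ext {true}  {true}  _ _ = ≡.refl

module FinGroupProperties (G : FinGroup) where
  open import Data.Nat using (_+_; _*_; _∸_; _≤_; z≤n; s≤s; NonZero; ≢-nonZero; >-nonZero)
  open import Data.Nat.Properties
  open import Data.Nat.Divisibility
    using (_∣_; divides; ∣-trans; ∣-antisym; ∣⇒≤; n∣m*n; m%n≡0⇒n∣m; *-cancelˡ-∣; *-cancelʳ-∣)
  open import Data.Nat.DivMod using (_%_; _/_; m≡m%n+[m/n]*n; m%n<n)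
  open import Data.Nat.GCD using (module Bézout; GCD)
  open import Data.Nat.Tactic.RingSolver using (solve-∀)
  open import Data.Fin.Properties using (pigeonhole; toℕ<n)
  open import Data.List using (upTo)
  open import Data.List.Relation.Unary.Any.Properties using (any⁺; any⁻)
  open import Data.List.Membership.Propositional using (find; lose)
  open import Data.List.Membership.Propositional.Properties using (∈-upTo⁺)
  open FinGroup G
  open ≡ using (refl; sym; trans; cong; subst; module ≡-Reasoning)
  open ≡-Reasoning

  infixl 30 _^ᴳ_
  _^ᴳ_ : Fin card → ℕ → Fin card
  _^ᴳ_ = pow G

  ·-cancelˡ : ∀ a {b c} → a · b ≡ a · c → b ≡ c
  ·-cancelˡ a {b} {c} eq = begin
    b                 ≡⟨ idˡ b ⟨
    e · b             ≡⟨ cong (_· b) (invˡ a) ⟨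
    (inv a · a) · b   ≡⟨ assoc _ _ _ ⟩
    inv a · (a · b)   ≡⟨ cong (inv a ·_) eq ⟩
    inv a · (a · c)   ≡⟨ assoc _ _ _ ⟨
    (inv a · a) · c   ≡⟨ cong (_· c) (invˡ a) ⟩
    e · c             ≡⟨ idˡ c ⟩
    c                 ∎

  ^ᴳ-+ : ∀ g m n → g ^ᴳ (m + n) ≡ g ^ᴳ m · g ^ᴳ n
  ^ᴳ-+ g zero    n = sym (idˡ _)
  ^ᴳ-+ g (suc m) n = trans (cong (g ·_) (^ᴳ-+ g m n)) (sym (assoc _ _ _))

  e^ᴳ : ∀ n → e ^ᴳ n ≡ e
  e^ᴳ zero    = refl
  e^ᴳ (suc n) = trans (idˡ _) (e^ᴳ n)

  ^ᴳ-* : ∀ g m n → g ^ᴳ (m * n) ≡ (g ^ᴳ m) ^ᴳ n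
  ^ᴳ-* g m zero    = cong (g ^ᴳ_) (*-zeroʳ m)
  ^ᴳ-* g m (suc n) = begin
    g ^ᴳ (m * suc n)           ≡⟨ cong (g ^ᴳ_) (*-suc m n) ⟩
    g ^ᴳ (m + m * n)           ≡⟨ ^ᴳ-+ g m (m * n) ⟩
    g ^ᴳ m · g ^ᴳ (m * n)      ≡⟨ cong (g ^ᴳ m ·_) (^ᴳ-* g m n) ⟩
    g ^ᴳ m · (g ^ᴳ m) ^ᴳ n     ∎

  ^ᴳ-1 : ∀ g → g ^ᴳ 1 ≡ g
  ^ᴳ-1 = idʳ

  module _ {g : Fin card} {n : ℕ} (o : IsOrder G g n) where

    private instance
      n≢0 : NonZero n
      n≢0 = >-nonZero (proj₁ o)

    order∣⇒^ᴳ≡e : ∀ {k} → n ∣ k → g ^ᴳ k ≡ e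
    order∣⇒^ᴳ≡e (divides q refl) = begin
      g ^ᴳ (q * n)     ≡⟨ cong (g ^ᴳ_) (*-comm q n) ⟩
      g ^ᴳ (n * q)     ≡⟨ ^ᴳ-* g n q ⟩
      (g ^ᴳ n) ^ᴳ q    ≡⟨ cong (_^ᴳ q) (proj₁ (proj₂ o)) ⟩
      e ^ᴳ q           ≡⟨ e^ᴳ q ⟩
      e                ∎

    ^ᴳ-mod : ∀ k → g ^ᴳ k ≡ g ^ᴳ (k % n)
    ^ᴳ-mod k = begin
      g ^ᴳ k                                  ≡⟨ cong (g ^ᴳ_) (m≡m%n+[m/n]*n k n) ⟩
      g ^ᴳ (k % n + (k / n) * n)              ≡⟨ ^ᴳ-+ g (k % n) _ ⟩
      g ^ᴳ (k % n) · g ^ᴳ ((k / n) * n)       ≡⟨ cong (g ^ᴳ (k % n) ·_) (order∣⇒^ᴳ≡e (n∣m*n (k / n))) ⟩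
      g ^ᴳ (k % n) · e                        ≡⟨ idʳ _ ⟩
      g ^ᴳ (k % n)                            ∎

    ^ᴳ≡e⇒order∣ : ∀ {k} → g ^ᴳ k ≡ e → n ∣ k
    ^ᴳ≡e⇒order∣ {k} gᵏ≡e with k % n in eq
    ... | zero  = m%n≡0⇒n∣m k n eq
    ... | suc j = ⊥-elim (proj₂ (proj₂ o) (suc j) (s≤s z≤n) (subst (_< n) eq (m%n<n k n))
                    (trans (cong (g ^ᴳ_) (sym eq)) (trans (sym (^ᴳ-mod k)) gᵏ≡e)))

    ^ᴳ-injective-below-order : ∀ {i j} → i < j → j < n → g ^ᴳ i ≢ g ^ᴳ j
    ^ᴳ-injective-below-order {i} {j} i<j j<n gⁱ≡gʲ =
      proj₂ (proj₂ o) (j ∸ i) (m<n⇒0<n∸m i<j) (≤-<-trans (m∸n≤m j i) j<n) (·-cancelˡ (g ^ᴳ i) (begin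
        g ^ᴳ i · g ^ᴳ (j ∸ i)   ≡⟨ ^ᴳ-+ g i (j ∸ i) ⟨
        g ^ᴳ (i + (j ∸ i))      ≡⟨ cong (g ^ᴳ_) (m+[n∸m]≡n (<⇒≤ i<j)) ⟩
        g ^ᴳ j                  ≡⟨ gⁱ≡gʲ ⟨
        g ^ᴳ i                  ≡⟨ idʳ _ ⟨
        g ^ᴳ i · e              ∎))

    order≤card : n ≤ card
    order≤card with n ≤? card
    ... | yes n≤card = n≤card
    ... | no n≰card with pigeonhole (≰⇒> n≰card) (λ (i : Fin n) → g ^ᴳ toℕ i)
    ...   | i , j , i<j , eq = ⊥-elim (^ᴳ-injective-below-order i<j (toℕ<n j) eq)

  order-unique : ∀ {g m n} → IsOrder G g m → IsOrder G g n → m ≡ n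
  order-unique oₘ oₙ =
    ∣-antisym (^ᴳ≡e⇒order∣ oₘ (proj₁ (proj₂ oₙ))) (^ᴳ≡e⇒order∣ oₙ (proj₁ (proj₂ oₘ)))

  order>1⇒≢e : ∀ {g n} → IsOrder G g n → 1 < n → g ≢ e
  order>1⇒≢e o 1<n g≡e = proj₂ (proj₂ o) 1 ≤-refl 1<n (trans (^ᴳ-1 _) g≡e)

  infix 4 _∈⟨_⟩ _∈⟨_⟩⁺

  _∈⟨_⟩ : Fin card → Fin card → Set
  x ∈⟨ y ⟩ = ∃ λ k → y ^ᴳ k ≡ x

  _∈⟨_⟩⁺ : Fin card → Fin card → Set
  x ∈⟨ y ⟩⁺ = ∃ λ k → y ^ᴳ suc k ≡ x

  ∈⟨⟩-refl : ∀ x → x ∈⟨ x ⟩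
  ∈⟨⟩-refl x = 1 , ^ᴳ-1 x

  ∈⟨⟩-trans : ∀ {x y z} → x ∈⟨ y ⟩ → y ∈⟨ z ⟩ → x ∈⟨ z ⟩
  ∈⟨⟩-trans {z = z} (k , refl) (j , refl) = j * k , ^ᴳ-* z j k

  ∈⟨⟩⇒∈⟨⟩⁺ : ∀ {x y} → x ∈⟨ y ⟩ → x ≢ e → x ∈⟨ y ⟩⁺
  ∈⟨⟩⇒∈⟨⟩⁺ (zero  , y⁰≡x) x≢e = ⊥-elim (x≢e (sym y⁰≡x))
  ∈⟨⟩⇒∈⟨⟩⁺ (suc k , yᵏ≡x) _   = k , yᵏ≡x

  ∈⟨⟩⁺⇒∈⟨⟩ : ∀ {x y} → x ∈⟨ y ⟩⁺ → x ∈⟨ y ⟩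
  ∈⟨⟩⁺⇒∈⟨⟩ (k , yᵏ≡x) = suc k , yᵏ≡x

  order-∣-∈⟨⟩ : ∀ {x y a b} → x ∈⟨ y ⟩ → IsOrder G x a → IsOrder G y b → a ∣ b
  order-∣-∈⟨⟩ {y = y} {b = b} (k , refl) oˣ oʸ =
    ^ᴳ≡e⇒order∣ oˣ (trans (sym (^ᴳ-* y k b)) (order∣⇒^ᴳ≡e oʸ (n∣m*n k)))

  inCyc⇒∈⟨⟩ : ∀ {x y} → T (inCyc G x y) → x ∈⟨ y ⟩
  inCyc⇒∈⟨⟩ t with find (any⁻ _ (upTo (suc card)) t)
  ... | k , _ , yᵏ≟x = k , T-does⇒ (_ ≟ᶠ _) yᵏ≟x

  ∈⟨⟩⇒inCyc : ∀ {x y n} → IsOrder G y n → x ∈⟨ y ⟩ → T (inCyc G x y)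
  ∈⟨⟩⇒inCyc {n = suc n} o (k , yᵏ≡x) =
    any⁺ _ (lose (∈-upTo⁺ (s≤s (≤-trans (<⇒≤ (m%n<n k (suc n))) (order≤card o))))
                 (⇒T-does (_ ≟ᶠ _) (trans (sym (^ᴳ-mod o k)) yᵏ≡x)))

  posPow⇒∈⟨⟩⁺ : ∀ {x y} → T (posPow G x y) → x ∈⟨ y ⟩⁺
  posPow⇒∈⟨⟩⁺ t with find (any⁻ _ (upTo card) t)
  ... | k , _ , yᵏ≟x = k , T-does⇒ (_ ≟ᶠ _) yᵏ≟x

  -- posPow only tries the exponents 1 … |G|, so k + 1 is reduced modulo o(y) into 1 … o(y).
  ∈⟨⟩⁺⇒posPow : ∀ {x y n} → IsOrder G y n → x ∈⟨ y ⟩⁺ → T (posPow G x y)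
  ∈⟨⟩⁺⇒posPow {x} {y} {suc n} o (k , yᵏ≡x) with suc k % suc n in r
  ... | zero  = any⁺ _ (lose (∈-upTo⁺ {i = n} (order≤card o)) (⇒T-does (_ ≟ᶠ _) (begin
        y ^ᴳ suc n   ≡⟨ proj₁ (proj₂ o) ⟩
        e            ≡⟨ order∣⇒^ᴳ≡e o (m%n≡0⇒n∣m (suc k) (suc n) r) ⟨
        y ^ᴳ suc k   ≡⟨ yᵏ≡x ⟩
        x            ∎)))
  ... | suc j = any⁺ _ (lose (∈-upTo⁺ {i = j} (≤-trans (<⇒≤ (subst (_< suc n) r (m%n<n (suc k) (suc n)))) (order≤card o)))
                  (⇒T-does (_ ≟ᶠ _) (trans (cong (y ^ᴳ_) (sym r)) (trans (sym (^ᴳ-mod o (suc k))) yᵏ≡x))))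

  adj⇒ : ∀ {u w} → T (adj G u w) → u ≢ w × (u ∈⟨ w ⟩⁺ ⊎ w ∈⟨ u ⟩⁺)
  adj⇒ {u} {w} t with u ≟ᶠ w
  ... | no u≢w = u≢w , ⊎.map posPow⇒∈⟨⟩⁺ posPow⇒∈⟨⟩⁺ (Equivalence.to T-∨ t)

  ⇒adj : ∀ {u w m n} → IsOrder G u m → IsOrder G w n → u ≢ w → u ∈⟨ w ⟩⁺ ⊎ w ∈⟨ u ⟩⁺ → T (adj G u w)
  ⇒adj {u} {w} oᵘ oʷ u≢w u~w with u ≟ᶠ w
  ... | yes u≡w = u≢w u≡w
  ... | no _    = Equivalence.from T-∨ (⊎.map (∈⟨⟩⁺⇒posPow oʷ) (∈⟨⟩⁺⇒posPow oᵘ) u~w)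

  adj-sym : ∀ u w → adj G u w ≡ adj G w u
  adj-sym u w with u ≟ᶠ w | w ≟ᶠ u
  ... | yes _   | yes _   = refl
  ... | yes u≡w | no w≢u  = ⊥-elim (w≢u (sym u≡w))
  ... | no u≢w  | yes w≡u = ⊥-elim (u≢w (sym w≡u))
  ... | no _    | no _    = ∨-comm (posPow G u w) (posPow G w u)

  d^g∈⟨d^k⟩ : ∀ {d n k g} → IsOrder G d (suc n) → Bézout.Identity g k (suc n) → d ^ᴳ g ∈⟨ d ^ᴳ k ⟩
  d^g∈⟨d^k⟩ {d} {n} {k} {g} o (Bézout.+- X Y eq) = X , (begin
    (d ^ᴳ k) ^ᴳ X                ≡⟨ ^ᴳ-* d k X ⟨
    d ^ᴳ (k * X)                 ≡⟨ cong (d ^ᴳ_) (trans (*-comm k X) (sym eq)) ⟩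
    d ^ᴳ (g + Y * suc n)         ≡⟨ ^ᴳ-+ d g _ ⟩
    d ^ᴳ g · d ^ᴳ (Y * suc n)    ≡⟨ cong (d ^ᴳ g ·_) (order∣⇒^ᴳ≡e o (n∣m*n Y)) ⟩
    d ^ᴳ g · e                   ≡⟨ idʳ _ ⟩
    d ^ᴳ g                       ∎)
  d^g∈⟨d^k⟩ {d} {n} {k} {g} o (Bézout.-+ X Y eq) = X * n , (begin
    (d ^ᴳ k) ^ᴳ (X * n)                        ≡⟨ ^ᴳ-* d k (X * n) ⟨
    d ^ᴳ (k * (X * n))                         ≡⟨ idʳ _ ⟨
    d ^ᴳ (k * (X * n)) · e                     ≡⟨ cong (d ^ᴳ (k * (X * n)) ·_) (order∣⇒^ᴳ≡e o (n∣m*n Y)) ⟨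
    d ^ᴳ (k * (X * n)) · d ^ᴳ (Y * suc n)      ≡⟨ ^ᴳ-+ d (k * (X * n)) (Y * suc n) ⟨
    d ^ᴳ (k * (X * n) + Y * suc n)             ≡⟨ cong (λ t → d ^ᴳ (k * (X * n) + t)) eq ⟨
    d ^ᴳ (k * (X * n) + (g + X * k))           ≡⟨ cong (d ^ᴳ_) (rearrange g X k n) ⟩
    d ^ᴳ (g + (X * k) * suc n)                 ≡⟨ ^ᴳ-+ d g _ ⟩
    d ^ᴳ g · d ^ᴳ ((X * k) * suc n)            ≡⟨ cong (d ^ᴳ g ·_) (order∣⇒^ᴳ≡e o (n∣m*n (X * k))) ⟩
    d ^ᴳ g · e                                 ≡⟨ idʳ _ ⟩
    d ^ᴳ g                                     ∎)
    where
    rearrange : ∀ g X k n → k * (X * n) + (g + X * k) ≡ g + (X * k) * suc n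
    rearrange = solve-∀

  -- In the cyclic group ⟨d⟩ of order n, ⟨d^k⟩ = ⟨d^g⟩ with g = gcd k n, a subgroup of
  -- order n/g; an element d^j whose order divides n/g therefore has g ∣ j.
  order∣⇒∈⟨⟩ : ∀ {x y d a b n} → IsOrder G x a → IsOrder G y b → IsOrder G d n →
               x ∈⟨ d ⟩ → y ∈⟨ d ⟩ → a ∣ b → x ∈⟨ y ⟩
  order∣⇒∈⟨⟩ {d = d} {a} {n = suc n} oˣ oʸ oᵈ (j , refl) (k , refl) a∣b
    with Bézout.lemma k (suc n)
  ... | Bézout.result g gcd bez = ∈⟨⟩-trans d^j∈⟨d^g⟩ (d^g∈⟨d^k⟩ oᵈ bez)
    where
    open _∣_ (GCD.gcd∣n gcd) renaming (quotient to q; equality to n≡q*g)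
    open _∣_ (GCD.gcd∣m gcd) renaming (quotient to k′; equality to k≡k′*g)
    instance
      q≢0 : NonZero q
      q≢0 = ≢-nonZero λ q≡0 → 1+n≢0 (trans n≡q*g (cong (_* g) q≡0))
    [d^k]^q≡e : (d ^ᴳ k) ^ᴳ q ≡ e
    [d^k]^q≡e = trans (sym (^ᴳ-* d k q)) (order∣⇒^ᴳ≡e oᵈ (divides k′ (begin
      k * q          ≡⟨ cong (_* q) k≡k′*g ⟩
      k′ * g * q     ≡⟨ *-assoc k′ g q ⟩
      k′ * (g * q)   ≡⟨ cong (k′ *_) (trans (*-comm g q) (sym n≡q*g)) ⟩
      k′ * suc n     ∎)))
    a∣q : a ∣ q
    a∣q = ∣-trans a∣b (^ᴳ≡e⇒order∣ oʸ [d^k]^q≡e)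
    g∣j : g ∣ j
    g∣j = *-cancelʳ-∣ q (subst (_∣ j * q) (trans n≡q*g (*-comm q g))
            (^ᴳ≡e⇒order∣ oᵈ (trans (^ᴳ-* d j q) (order∣⇒^ᴳ≡e oˣ a∣q))))
    d^j∈⟨d^g⟩ : d ^ᴳ j ∈⟨ d ^ᴳ g ⟩
    d^j∈⟨d^g⟩ with g∣j
    ... | divides j′ refl = j′ , trans (sym (^ᴳ-* d g j′)) (cong (d ^ᴳ_) (*-comm g j′))

  order-^ᴳ : ∀ {d n a m} → IsOrder G d n → n ≡ a * m → IsOrder G (d ^ᴳ a) m
  order-^ᴳ {d} {n} {a} {m} o n≡a*m = 1≤m , d^a^m≡e , minimal
    where
    1≤m : 1 ≤ m
    1≤m = n≢0⇒n>0 λ m≡0 → <⇒≢ (proj₁ o) (sym (trans n≡a*m (trans (cong (a *_) m≡0) (*-zeroʳ a))))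
    d^a^m≡e : (d ^ᴳ a) ^ᴳ m ≡ e
    d^a^m≡e = trans (sym (^ᴳ-* d a m)) (order∣⇒^ᴳ≡e o (divides 1 (trans (sym n≡a*m) (sym (*-identityˡ n)))))
    instance
      a≢0 : NonZero a
      a≢0 = ≢-nonZero λ a≡0 → <⇒≢ (proj₁ o) (sym (trans n≡a*m (cong (_* m) a≡0)))
    minimal : ∀ j → 1 ≤ j → j < m → (d ^ᴳ a) ^ᴳ j ≢ e
    minimal j 1≤j j<m d^a^j≡e = <⇒≱ j<m (∣⇒≤ {{>-nonZero 1≤j}} (*-cancelˡ-∣ a
      (subst (_∣ a * j) n≡a*m (^ᴳ≡e⇒order∣ o (trans (^ᴳ-* d a j) d^a^j≡e)))))

module Counting where
  open import Data.Nat using (_+_; _*_; _<_; NonZero)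
  open import Data.Nat.Properties using (+-suc; +-*-semiring; *-comm; *-monoʳ-<; *-cancelˡ-<; *-cancelˡ-≡)
  open import Data.Nat.Divisibility using (divides; _∣?_)
  open import Data.Fin using (fromℕ<)
  open import Data.Fin.Properties using (toℕ<n; toℕ-fromℕ<; toℕ-injective)
  open import Data.List using (filter; length; tabulate)
  open import Relation.Nullary.Decidable using (T?)
  open ≡ using (refl; sym; trans; cong; subst; module ≡-Reasoning)
  open import Algebra.Properties.Semiring.Sum +-*-semiring
    using (sum; sum-cong-≗; sum-replicate-zero; ∑-comm; ∑-distrib-+)

  ♯ : ∀ {n} → (Fin n → Bool) → ℕ
  ♯ P = sum (λ i → if P i then 1 else 0)

  ♯-cong : ∀ {n} {P Q : Fin n → Bool} → (∀ i → P i ≡ Q i) → ♯ P ≡ ♯ Q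
  ♯-cong P≗Q = sum-cong-≗ (λ i → cong (λ b → if b then 1 else 0) (P≗Q i))

  length-filter-tabulate : ∀ {n m} (f : Fin n → Fin m) (P : Fin m → Bool) →
    length (filter (λ x → T? (P x)) (tabulate f)) ≡ ♯ (P ∘ f)
  length-filter-tabulate {zero}  f P = refl
  length-filter-tabulate {suc n} f P with P (f zero)
  ... | true  = cong suc (length-filter-tabulate (f ∘ suc) P)
  ... | false = length-filter-tabulate (f ∘ suc) P

  count≡♯ : ∀ G (P : Fin (FinGroup.card G) → Bool) → count G P ≡ ♯ P
  count≡♯ G P = length-filter-tabulate (λ x → x) P

  ♯-const-true : ∀ n → ♯ {n} (λ _ → true) ≡ n
  ♯-const-true zero    = refl
  ♯-const-true (suc n) = cong suc (♯-const-true n)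

  ♯-none : ∀ {n} {P : Fin n → Bool} → (∀ i → ¬ T (P i)) → ♯ P ≡ 0
  ♯-none {n} ¬P = trans (♯-cong λ i → T-ext (λ Pᵢ → ¬P i Pᵢ) λ ()) (sum-replicate-zero n)

  ♯-≟ : ∀ {n} (i₀ : Fin n) → ♯ (λ i → does (i₀ ≟ᶠ i)) ≡ 1
  ♯-≟ {suc n} zero    = cong suc (♯-none {n} λ _ ())
  ♯-≟ {suc n} (suc i₀) = ♯-≟ i₀

  ♯-unique : ∀ {n} {P : Fin n → Bool} (i₀ : Fin n) → T (P i₀) → (∀ i → T (P i) → i₀ ≡ i) → ♯ P ≡ 1
  ♯-unique {P = P} i₀ Pi₀ uniq = trans (♯-cong λ i → T-ext (⇒T-does (i₀ ≟ᶠ i) ∘ uniq i) (reach i)) (♯-≟ i₀)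
    where
    reach : ∀ i → T (does (i₀ ≟ᶠ i)) → T (P i)
    reach i t with T-does⇒ (i₀ ≟ᶠ i) t
    ... | refl = Pi₀

  ♯-∨ : ∀ {n} (P Q : Fin n → Bool) → (∀ i → T (P i) → ¬ T (Q i)) → ♯ (λ i → P i ∨ Q i) ≡ ♯ P + ♯ Q
  ♯-∨ P Q disjoint = trans (sum-cong-≗ pointwise) (∑-distrib-+ (λ i → if P i then 1 else 0) (λ i → if Q i then 1 else 0))
    where
    pointwise : ∀ i → (if P i ∨ Q i then 1 else 0) ≡ (if P i then 1 else 0) + (if Q i then 1 else 0)
    pointwise i with P i | Q i | disjoint i
    ... | true  | true  | d = ⊥-elim (d _ _)
    ... | true  | false | _ = refl
    ... | false | _     | _ = refl

  ♯-not : ∀ {n} (P : Fin n → Bool) → ♯ (not ∘ P) + ♯ P ≡ n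
  ♯-not {zero}  P = refl
  ♯-not {suc n} P with P zero | ♯-not (P ∘ suc)
  ... | true  | ih = trans (+-suc _ _) (cong suc ih)
  ... | false | ih = cong suc ih

  -- Double counting of the pairs (k , w) with f k ≡ w and P k.
  ♯-injection : ∀ {a b} (f : Fin a → Fin b) {P : Fin a → Bool} {Q : Fin b → Bool} →
    (∀ i j → f i ≡ f j → i ≡ j) → (∀ k → T (P k) → T (Q (f k))) →
    (∀ w → T (Q w) → ∃ λ k → f k ≡ w × T (P k)) → ♯ Q ≡ ♯ P
  ♯-injection {a} {b} f {P} {Q} f-inj P⇒Q Q⇒P = begin
    ♯ Q                                                 ≡⟨ sum-cong-≗ row ⟩
    sum (λ w → sum (λ k → if E k w then 1 else 0))      ≡⟨ ∑-comm (λ w k → if E k w then 1 else 0) ⟩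
    sum (λ k → sum (λ w → if E k w then 1 else 0))      ≡⟨ sum-cong-≗ column ⟩
    ♯ P                                                 ∎
    where
    open ≡-Reasoning
    E : Fin a → Fin b → Bool
    E k w = P k ∧ does (f k ≟ᶠ w)
    E⇒ : ∀ {k w} → T (E k w) → T (P k) × f k ≡ w
    E⇒ {k} {w} t with Equivalence.to T-∧ t
    ... | Pk , fk≟w = Pk , T-does⇒ (f k ≟ᶠ w) fk≟w
    row : ∀ w → (if Q w then 1 else 0) ≡ ♯ (λ k → E k w)
    row w with Q w in Qw
    ... | true with Q⇒P w (subst T (sym Qw) _)
    ...   | k₀ , refl , Pk₀ = sym (♯-unique {P = λ k → E k w} k₀ (Equivalence.from T-∧ (Pk₀ , ⇒T-does (f k₀ ≟ᶠ w) refl))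
                                 λ k Ekw → f-inj k₀ k (sym (proj₂ (E⇒ Ekw))))
    row w | false = sym (♯-none {P = λ k → E k w} λ k Ekw → case E⇒ Ekw of λ { (Pk , refl) → subst T Qw (P⇒Q k Pk) })
    column : ∀ k → ♯ (E k) ≡ (if P k then 1 else 0)
    column k with P k
    ... | true  = ♯-unique {P = λ w → does (f k ≟ᶠ w)} (f k) (⇒T-does (f k ≟ᶠ f k) refl) λ w → T-does⇒ (f k ≟ᶠ w)
    ... | false = ♯-none {b} {λ _ → false} λ _ ()

  ♯-multiples : ∀ d m .{{_ : NonZero d}} → ♯ {d * m} (λ k → does (d ∣? toℕ k)) ≡ m
  ♯-multiples d m = trans (♯-injection d* d*-injective d∣d* onto) (♯-const-true m)
    where
    d* : Fin m → Fin (d * m)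
    d* j = fromℕ< (*-monoʳ-< d (toℕ<n j))
    toℕ-d* : ∀ j → toℕ (d* j) ≡ d * toℕ j
    toℕ-d* j = toℕ-fromℕ< (*-monoʳ-< d (toℕ<n j))
    d*-injective : ∀ i j → d* i ≡ d* j → i ≡ j
    d*-injective i j eq = toℕ-injective (*-cancelˡ-≡ (toℕ i) (toℕ j) d
      (trans (sym (toℕ-d* i)) (trans (cong toℕ eq) (toℕ-d* j))))
    d∣d* : ∀ j → T true → T (does (d ∣? toℕ (d* j)))
    d∣d* j _ = ⇒T-does (d ∣? _) (divides (toℕ j) (trans (toℕ-d* j) (*-comm d (toℕ j))))
    onto : ∀ k → T (does (d ∣? toℕ k)) → ∃ λ j → d* j ≡ k × T true
    onto k t with T-does⇒ (d ∣? toℕ k) t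
    ... | divides q k≡q*d = fromℕ< q<m , toℕ-injective (begin
        toℕ (d* (fromℕ< q<m))   ≡⟨ toℕ-d* _ ⟩
        d * toℕ (fromℕ< q<m)    ≡⟨ cong (d *_) (toℕ-fromℕ< q<m) ⟩
        d * q                   ≡⟨ *-comm d q ⟩
        q * d                   ≡⟨ k≡q*d ⟨
        toℕ k                   ∎) , _
      where
      open ≡-Reasoning
      q<m : q < m
      q<m = *-cancelˡ-< d q m (subst (_< d * m) (trans k≡q*d (*-comm q d)) (toℕ<n k))

module RingSums {c ℓ : Level} (R : CommutativeRing c ℓ) where
  import Data.Nat as ℕ
  open CommutativeRing R hiding (zero)
  open import Algebra.Properties.Semiring.Sum semiring public
    using (sum; sum-cong-≋; sum-replicate-zero; ∑-comm; ∑-distrib-+; *-distribˡ-sum)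
  open import Algebra.Properties.Ring ring using (-0#≈0#; -‿+-comm; -‿distribˡ-*)
  open import Algebra.Properties.Group +-group using (⁻¹-anti-homo-//)
  open import Relation.Binary.Reasoning.Setoid setoid
  open Counting using (♯)

  ≡⇒≈ : ∀ {x y} → x ≡ y → x ≈ y
  ≡⇒≈ ≡.refl = refl

  sumR≡sum : ∀ {n} (f : Fin n → Carrier) → sumR R f ≡ sum f
  sumR≡sum {zero}  f = ≡.refl
  sumR≡sum {suc n} f = ≡.cong (f zero +_) (sumR≡sum (f ∘ suc))

  ℕ→R-+ : ∀ m n → ℕ→R R (m ℕ.+ n) ≈ ℕ→R R m + ℕ→R R n
  ℕ→R-+ zero    n = sym (+-identityˡ _)
  ℕ→R-+ (suc m) n = trans (+-congˡ (ℕ→R-+ m n)) (sym (+-assoc _ _ _))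

  ∑-neg : ∀ {n} (f : Fin n → Carrier) → sum (λ i → - f i) ≈ - sum f
  ∑-neg {zero}  f = sym -0#≈0#
  ∑-neg {suc n} f = trans (+-congˡ (∑-neg (f ∘ suc))) (-‿+-comm _ _)

  ∑-if-const : ∀ {n} (Q : Fin n → Bool) a → sum (λ i → if Q i then a else 0#) ≈ ℕ→R R (♯ Q) * a
  ∑-if-const {zero}  Q a = sym (zeroˡ a)
  ∑-if-const {suc n} Q a with Q zero
  ... | true  = begin
    a + sum (λ i → if Q (suc i) then a else 0#)   ≈⟨ +-cong (sym (*-identityˡ a)) (∑-if-const (Q ∘ suc) a) ⟩
    1# * a + ℕ→R R (♯ (Q ∘ suc)) * a              ≈⟨ distribʳ a 1# _ ⟨
    (1# + ℕ→R R (♯ (Q ∘ suc))) * a                ∎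
  ... | false = trans (+-identityˡ _) (∑-if-const (Q ∘ suc) a)

  ∑-if-zero : ∀ {n} (Q : Fin n → Bool) (f : Fin n → Carrier) → (∀ i → T (Q i) → f i ≈ 0#) →
    sum (λ i → if Q i then f i else 0#) ≈ 0#
  ∑-if-zero {n} Q f f≈0 = trans (sum-cong-≋ pointwise) (sum-replicate-zero n)
    where
    pointwise : ∀ i → (if Q i then f i else 0#) ≈ 0#
    pointwise i with Q i in Qi
    ... | true  = f≈0 i (≡.subst T (≡.sym Qi) _)
    ... | false = refl

  ∑-if-∨ : ∀ {n} (P Q : Fin n → Bool) (f : Fin n → Carrier) → (∀ i → T (P i) → ¬ T (Q i)) →
    sum (λ i → if P i ∨ Q i then f i else 0#) ≈ sum (λ i → if P i then f i else 0#) + sum (λ i → if Q i then f i else 0#)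
  ∑-if-∨ P Q f disjoint =
    trans (sum-cong-≋ pointwise) (∑-distrib-+ (λ i → if P i then f i else 0#) (λ i → if Q i then f i else 0#))
    where
    pointwise : ∀ i → (if P i ∨ Q i then f i else 0#) ≈ (if P i then f i else 0#) + (if Q i then f i else 0#)
    pointwise i with P i | Q i | disjoint i
    ... | true  | true  | d = ⊥-elim (d _ _)
    ... | true  | false | _ = sym (+-identityʳ _)
    ... | false | _     | _ = sym (+-identityˡ _)

  ∑-if-diff : ∀ {n} (Q : Fin n → Bool) a (f : Fin n → Carrier) →
    sum (λ i → if Q i then a - f i else 0#) ≈ ℕ→R R (♯ Q) * a - sum (λ i → if Q i then f i else 0#)
  ∑-if-diff Q a f = begin
    sum (λ i → if Q i then a - f i else 0#)
      ≈⟨ sum-cong-≋ split ⟩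
    sum (λ i → (if Q i then a else 0#) + - (if Q i then f i else 0#))
      ≈⟨ ∑-distrib-+ (λ i → if Q i then a else 0#) _ ⟩
    sum (λ i → if Q i then a else 0#) + sum (λ i → - (if Q i then f i else 0#))
      ≈⟨ +-cong (∑-if-const Q a) (∑-neg (λ i → if Q i then f i else 0#)) ⟩
    ℕ→R R (♯ Q) * a - sum (λ i → if Q i then f i else 0#) ∎
    where
    split : ∀ i → (if Q i then a - f i else 0#) ≈ (if Q i then a else 0#) + - (if Q i then f i else 0#)
    split i with Q i
    ... | true  = refl
    ... | false = sym (trans (+-congˡ -0#≈0#) (+-identityˡ _))

  ∑∑-antisymmetric : ∀ {n} (F : Fin n → Fin n → Carrier) → (∀ i j → F i j + F j i ≈ 0#) →
    sum (λ i → sum (F i)) + sum (λ i → sum (F i)) ≈ 0#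
  ∑∑-antisymmetric {n} F F-anti = begin
    sum (λ i → sum (F i)) + sum (λ i → sum (F i))            ≈⟨ +-congˡ (∑-comm F) ⟩
    sum (λ i → sum (F i)) + sum (λ i → sum (λ j → F j i))    ≈⟨ ∑-distrib-+ (λ i → sum (F i)) _ ⟨
    sum (λ i → sum (F i) + sum (λ j → F j i))                ≈⟨ sum-cong-≋ (λ i → ∑-distrib-+ (F i) _) ⟨
    sum (λ i → sum (λ j → F i j + F j i))                    ≈⟨ sum-cong-≋ (λ i → sum-cong-≋ (F-anti i)) ⟩
    sum {n} (λ i → sum {n} (λ _ → 0#))                       ≈⟨ sum-cong-≋ {n} (λ _ → sum-replicate-zero n) ⟩
    sum {n} (λ _ → 0#)                                       ≈⟨ sum-replicate-zero n ⟩
    0#                                                       ∎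

  [x-y]+[y-x]≈0 : ∀ x y → (x - y) + (y - x) ≈ 0#
  [x-y]+[y-x]≈0 x y = trans (+-congˡ (sym (⁻¹-anti-homo-// x y))) (-‿inverseʳ (x - y))

  [a+b]x-y≈zx⇒bx-y≈[z-a]x : ∀ a b x y z → (a + b) * x - y ≈ z * x → b * x - y ≈ (z - a) * x
  [a+b]x-y≈zx⇒bx-y≈[z-a]x a b x y z eq = begin
    b * x - y                          ≈⟨ +-identityˡ _ ⟨
    0# + (b * x - y)                   ≈⟨ +-congʳ (-‿inverseʳ (a * x)) ⟨
    (a * x - a * x) + (b * x - y)      ≈⟨ +-congʳ (+-comm (a * x) _) ⟩
    (- (a * x) + a * x) + (b * x - y)  ≈⟨ +-assoc _ _ _ ⟩
    - (a * x) + (a * x + (b * x - y))  ≈⟨ +-congˡ (+-assoc _ _ _) ⟨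
    - (a * x) + ((a * x + b * x) - y)  ≈⟨ +-congˡ (+-congʳ (distribʳ x a b)) ⟨
    - (a * x) + ((a + b) * x - y)      ≈⟨ +-congˡ eq ⟩
    - (a * x) + z * x                  ≈⟨ +-comm _ _ ⟩
    z * x - a * x                      ≈⟨ +-congˡ (-‿distribˡ-* a x) ⟩
    z * x + - a * x                    ≈⟨ distribʳ x z (- a) ⟨
    (z - a) * x                        ∎

  x*z≈y*z⇒[x-y]*z≈0 : ∀ x y z → x * z ≈ y * z → (x - y) * z ≈ 0#
  x*z≈y*z⇒[x-y]*z≈0 x y z xz≈yz = begin
    (x - y) * z          ≈⟨ distribʳ z x (- y) ⟩
    x * z + - y * z      ≈⟨ +-congˡ (sym (-‿distribˡ-* y z)) ⟩
    x * z - y * z        ≈⟨ +-congʳ xz≈yz ⟩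
    y * z - y * z        ≈⟨ -‿inverseʳ (y * z) ⟩
    0#                   ∎

  ≈ℕ→R⇒+≈ℕ→R : ∀ {x k} m q → x ≈ ℕ→R R m → m ℕ.+ q ≡ k → x + ℕ→R R q ≈ ℕ→R R k
  ≈ℕ→R⇒+≈ℕ→R m q x≈m ≡.refl = trans (+-congʳ x≈m) (sym (ℕ→R-+ m q))

  x+x≈0⇒x≈0 : IsDomainChar0 R → ∀ x → x + x ≈ 0# → x ≈ 0#
  x+x≈0⇒x≈0 (no-zero-divisors , char0) x x+x≈0 with no-zero-divisors (ℕ→R R 2) x (begin
    (1# + (1# + 0#)) * x   ≈⟨ *-congʳ (+-congˡ (+-identityʳ 1#)) ⟩
    (1# + 1#) * x          ≈⟨ distribʳ x 1# 1# ⟩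
    1# * x + 1# * x        ≈⟨ +-cong (*-identityˡ x) (*-identityˡ x) ⟩
    x + x                  ≈⟨ x+x≈0 ⟩
    0#                     ∎)
  ... | inj₁ 2≈0 = ⊥-elim (char0 1 2≈0)
  ... | inj₂ x≈0 = x≈0

module PGroupProperties (G : FinGroup) (p : ℕ) (1<p : 1 < p)
                        (isPGroup : ∀ g → ∃ λ m → IsOrder G g (p ^ m)) where
  open import Data.Nat using (_+_; _*_; _∸_; _≤_; s≤s; z<s; NonZero; >-nonZero)
  open import Data.Nat.Properties
  open import Data.Nat.Divisibility using (_∣_; divides; _∣?_; ∣-refl; ∣⇒≤; *-cancelʳ-∣; n∣m*n)
  open import Data.Nat.DivMod using (m%n<n)
  open import Data.Fin using (fromℕ<)
  open import Data.Fin.Properties using (toℕ<n; toℕ-fromℕ<; toℕ-injective)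
  open import Relation.Binary.Definitions using (tri<; tri≈; tri>)
  open ≡ using (refl; sym; trans; cong; cong₂; subst; subst₂; module ≡-Reasoning)
  open FinGroup G
  open FinGroupProperties G
  open Counting

  instance
    p≢0 : NonZero p
    p≢0 = >-nonZero (<-trans z<s 1<p)

  exponent : Fin card → ℕ
  exponent g = proj₁ (isPGroup g)

  order-exponent : ∀ g → IsOrder G g (p ^ exponent g)
  order-exponent g = proj₂ (isPGroup g)

  p^∣p^⇒≤ : ∀ {a b} → p ^ a ∣ p ^ b → a ≤ b
  p^∣p^⇒≤ {a} {b} p^a∣p^b with a ≤? b
  ... | yes a≤b = a≤b
  ... | no a≰b  = ⊥-elim (<⇒≱ (^-monoʳ-< p 1<p (≰⇒> a≰b)) (∣⇒≤ {{m^n≢0 p b}} p^a∣p^b))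

  ≤⇒p^∣p^ : ∀ {a b} → a ≤ b → p ^ a ∣ p ^ b
  ≤⇒p^∣p^ {a} {b} a≤b = divides (p ^ (b ∸ a))
    (trans (cong (p ^_) (sym (m∸n+n≡m a≤b))) (^-distribˡ-+-* p (b ∸ a) a))

  exponent-of-order : ∀ {h s} → IsOrder G h (p ^ s) → exponent h ≡ s
  exponent-of-order {h} {s} o with order-unique o (order-exponent h)
  ... | p^s≡p^e =
    ≤-antisym (p^∣p^⇒≤ (subst (_∣ p ^ s) p^s≡p^e ∣-refl)) (p^∣p^⇒≤ (subst (p ^ s ∣_) p^s≡p^e ∣-refl))

  exponent-mono : ∀ {x y} → x ∈⟨ y ⟩ → exponent x ≤ exponent y
  exponent-mono {x} {y} x∈⟨y⟩ = p^∣p^⇒≤ (order-∣-∈⟨⟩ x∈⟨y⟩ (order-exponent x) (order-exponent y))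

  exponent≤⇒∈⟨⟩ : ∀ {x y d} → x ∈⟨ d ⟩ → y ∈⟨ d ⟩ → exponent x ≤ exponent y → x ∈⟨ y ⟩
  exponent≤⇒∈⟨⟩ {x} {y} {d} x∈⟨d⟩ y∈⟨d⟩ ≤ =
    order∣⇒∈⟨⟩ (order-exponent x) (order-exponent y) (order-exponent d) x∈⟨d⟩ y∈⟨d⟩ (≤⇒p^∣p^ ≤)

  ⊂⇒exponent< : ∀ {x y} → x ∈⟨ y ⟩ → ¬ y ∈⟨ x ⟩ → exponent x < exponent y
  ⊂⇒exponent< {x} {y} x∈⟨y⟩ y∉⟨x⟩ with m≤n⇒m<n∨m≡n (exponent-mono x∈⟨y⟩)
  ... | inj₁ < = <
  ... | inj₂ ≡ = ⊥-elim (y∉⟨x⟩ (exponent≤⇒∈⟨⟩ (∈⟨⟩-refl y) x∈⟨y⟩ (≤-reflexive (sym ≡))))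

  ∈⟨⟩⇒inCyc′ : ∀ {x y} → x ∈⟨ y ⟩ → T (inCyc G x y)
  ∈⟨⟩⇒inCyc′ {y = y} = ∈⟨⟩⇒inCyc (order-exponent y)

  sameCyc⇒ : ∀ {w h} → T (sameCyc G w h) → w ∈⟨ h ⟩ × h ∈⟨ w ⟩
  sameCyc⇒ t with Equivalence.to T-∧ t
  ... | w∈⟨h⟩ , h∈⟨w⟩ = inCyc⇒∈⟨⟩ w∈⟨h⟩ , inCyc⇒∈⟨⟩ h∈⟨w⟩

  ⇒sameCyc : ∀ {w h} → w ∈⟨ h ⟩ → h ∈⟨ w ⟩ → T (sameCyc G w h)
  ⇒sameCyc w∈⟨h⟩ h∈⟨w⟩ = Equivalence.from T-∧ (∈⟨⟩⇒inCyc′ w∈⟨h⟩ , ∈⟨⟩⇒inCyc′ h∈⟨w⟩)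

  ∃-cover-in : ∀ {h u s} → IsOrder G h (p ^ suc s) → h ∈⟨ u ⟩ → ¬ u ∈⟨ h ⟩ →
    ∃ λ h′ → IsOrder G h′ (p ^ suc (suc s)) × h ∈⟨ h′ ⟩ × h′ ∈⟨ u ⟩
  ∃-cover-in {h} {u} {s} oʰ h∈⟨u⟩ u∉⟨h⟩ = u ^ᴳ k , oʰ′ , h∈⟨h′⟩ , (k , refl)
    where
    2+s≤exponent-u : suc (suc s) ≤ exponent u
    2+s≤exponent-u = subst (_< exponent u) (exponent-of-order oʰ) (⊂⇒exponent< h∈⟨u⟩ u∉⟨h⟩)
    k : ℕ
    k = p ^ (exponent u ∸ suc (suc s))
    oʰ′ : IsOrder G (u ^ᴳ k) (p ^ suc (suc s))
    oʰ′ = order-^ᴳ {a = k} (order-exponent u)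
      (trans (cong (p ^_) (sym (m∸n+n≡m 2+s≤exponent-u))) (^-distribˡ-+-* p (exponent u ∸ suc (suc s)) (suc (suc s))))
    h∈⟨h′⟩ : h ∈⟨ u ^ᴳ k ⟩
    h∈⟨h′⟩ = exponent≤⇒∈⟨⟩ h∈⟨u⟩ (k , refl)
      (subst₂ _≤_ (sym (exponent-of-order oʰ)) (sym (exponent-of-order oʰ′)) (n≤1+n (suc s)))

  [_] : Fin card → Fin card → Bool
  [ h ] w = sameCyc G w h

  order-p^[1+s]⇒≢e : ∀ {h s} → IsOrder G h (p ^ suc s) → h ≢ e
  order-p^[1+s]⇒≢e {s = s} oʰ = order>1⇒≢e oʰ (^-monoʳ-< p 1<p {0} {suc s} z<s)

  inU-trans : ∀ {x y w} → x ∈⟨ y ⟩ → T (inU G y w) → T (inU G x w)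
  inU-trans x∈⟨y⟩ y∈⟨w⟩ = ∈⟨⟩⇒inCyc′ (∈⟨⟩-trans x∈⟨y⟩ (inCyc⇒∈⟨⟩ y∈⟨w⟩))

  U-split : ∀ h w → inU G h w ≡ (inUhat G h w ∨ sameCyc G w h)
  U-split h w = absorb (inU G h w) (sameCyc G w h) (λ w∈[h] → ∈⟨⟩⇒inCyc′ (proj₂ (sameCyc⇒ w∈[h])))
    where
    absorb : ∀ a b → (T b → T a) → a ≡ (a ∧ not b) ∨ b
    absorb true  true  _   = refl
    absorb true  false _   = refl
    absorb false true  b⇒a = ⊥-elim (b⇒a _)
    absorb false false _   = refl

  class-adjacent : ∀ {h c w} → h ≢ e → T (sameCyc G c h) → T (inU G h w) → c ≢ w → T (adj G c w)
  class-adjacent {h} {c} {w} h≢e c∈[h] w∈U c≢w with sameCyc⇒ c∈[h]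
  ... | c∈⟨h⟩ , (k , cᵏ≡h) =
    ⇒adj (order-exponent c) (order-exponent w) c≢w (inj₁ (∈⟨⟩⇒∈⟨⟩⁺ (∈⟨⟩-trans c∈⟨h⟩ (inCyc⇒∈⟨⟩ w∈U)) c≢e))
    where
    c≢e : c ≢ e
    c≢e refl = h≢e (trans (sym cᵏ≡h) (e^ᴳ k))

  module _ {h h′ s} (oʰ : IsOrder G h (p ^ suc s)) (oʰ′ : IsOrder G h′ (p ^ suc (suc s)))
           (h∈⟨h′⟩ : h ∈⟨ h′ ⟩) where

    h′∉⟨h⟩ : ¬ h′ ∈⟨ h ⟩
    h′∉⟨h⟩ h′∈⟨h⟩ = <⇒≱ (n<1+n (suc s))
      (subst₂ _≤_ (exponent-of-order oʰ′) (exponent-of-order oʰ) (exponent-mono h′∈⟨h⟩))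

    class∉U : ∀ w → T (sameCyc G w h) → ¬ T (inU G h′ w)
    class∉U w w∈[h] w∈U′ = h′∉⟨h⟩ (∈⟨⟩-trans (inCyc⇒∈⟨⟩ w∈U′) (proj₁ (sameCyc⇒ w∈[h])))

    neighbours-split : ∀ {d} → h′ ∈⟨ d ⟩ → ∀ w →
      (inU G h w ∧ adj G d w) ≡ (sameCyc G w h ∨ (inU G h′ w ∧ adj G d w))
    neighbours-split {d} h′∈⟨d⟩ w = T-ext to from
      where
      to : T (inU G h w ∧ adj G d w) → T (sameCyc G w h ∨ (inU G h′ w ∧ adj G d w))
      to t with sameCyc G w h in w∈[h]? | Equivalence.to T-∧ t
      ... | true  | _ = _
      ... | false | w∈U , d~w = Equivalence.from T-∧ (∈⟨⟩⇒inCyc′ h′∈⟨w⟩ , d~w)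
        where
        h∈⟨w⟩ : h ∈⟨ w ⟩
        h∈⟨w⟩ = inCyc⇒∈⟨⟩ w∈U
        w∉⟨h⟩ : ¬ w ∈⟨ h ⟩
        w∉⟨h⟩ w∈⟨h⟩ = subst T w∈[h]? (⇒sameCyc w∈⟨h⟩ h∈⟨w⟩)
        exponent-h′≤ : exponent h′ ≤ exponent w
        exponent-h′≤ = subst (_≤ exponent w) (sym (exponent-of-order {s = suc (suc s)} oʰ′))
          (subst (_< exponent w) (exponent-of-order {s = suc s} oʰ) (⊂⇒exponent< h∈⟨w⟩ w∉⟨h⟩))
        h′∈⟨w⟩ : h′ ∈⟨ w ⟩
        h′∈⟨w⟩ with proj₂ (adj⇒ d~w)
        ... | inj₁ d∈⟨w⟩⁺ = ∈⟨⟩-trans h′∈⟨d⟩ (∈⟨⟩⁺⇒∈⟨⟩ d∈⟨w⟩⁺)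
        ... | inj₂ w∈⟨d⟩⁺ = exponent≤⇒∈⟨⟩ h′∈⟨d⟩ (∈⟨⟩⁺⇒∈⟨⟩ w∈⟨d⟩⁺) exponent-h′≤
      from : T (sameCyc G w h ∨ (inU G h′ w ∧ adj G d w)) → T (inU G h w ∧ adj G d w)
      from t with Equivalence.to T-∨ t
      ... | inj₂ t′ with Equivalence.to T-∧ t′
      ...   | w∈U′ , d~w = Equivalence.from T-∧ (inU-trans h∈⟨h′⟩ w∈U′ , d~w)
      from t | inj₁ w∈[h] with sameCyc⇒ w∈[h]
      ... | w∈⟨h⟩ , h∈⟨w⟩ = Equivalence.from T-∧ (∈⟨⟩⇒inCyc′ h∈⟨w⟩ ,
            ⇒adj (order-exponent d) (order-exponent w) d≢w (inj₂ (∈⟨⟩⇒∈⟨⟩⁺ w∈⟨d⟩ w≢e)))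
        where
        w∈⟨d⟩ : w ∈⟨ d ⟩
        w∈⟨d⟩ = ∈⟨⟩-trans w∈⟨h⟩ (∈⟨⟩-trans h∈⟨h′⟩ h′∈⟨d⟩)
        d≢w : d ≢ w
        d≢w refl = h′∉⟨h⟩ (∈⟨⟩-trans h′∈⟨d⟩ w∈⟨h⟩)
        w≢e : w ≢ e
        w≢e refl = order-p^[1+s]⇒≢e {s = s} oʰ (trans (sym (proj₂ h∈⟨w⟩)) (e^ᴳ (proj₁ h∈⟨w⟩)))

  -- The values m that the theorem allows for an eigenvalue of Γ(h), o(h) = p^{s+1}: zero,
  -- o(g₁) − p^s or |Û(g₂)| + o(g₂) − p^s with g₁, g₂ ∈ U(h), stated without subtraction.
  Admissible : Fin card → ℕ → ℕ → Set
  Admissible h s m =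
    m ≡ 0
    ⊎ (∃ λ g₁ → ∃ λ k → T (inU G h g₁) × IsOrder G g₁ k × m + p ^ s ≡ k)
    ⊎ (∃ λ g₂ → ∃ λ k → T (inU G h g₂) × IsOrder G g₂ k × m + p ^ s ≡ Uhat-size G g₂ + k)

  module _ {h s} (oʰ : IsOrder G h (p ^ suc s)) where

    p∣k⇒exponent≤ : ∀ {k} → p ∣ k → exponent (h ^ᴳ k) ≤ s
    p∣k⇒exponent≤ (divides q refl) = p^∣p^⇒≤ (^ᴳ≡e⇒order∣ (order-exponent _) (begin
      (h ^ᴳ (q * p)) ^ᴳ (p ^ s)   ≡⟨ ^ᴳ-* h (q * p) (p ^ s) ⟨
      h ^ᴳ (q * p * p ^ s)        ≡⟨ cong (h ^ᴳ_) (*-assoc q p (p ^ s)) ⟩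
      h ^ᴳ (q * p ^ suc s)        ≡⟨ order∣⇒^ᴳ≡e oʰ (n∣m*n q) ⟩
      e                           ∎))
      where open ≡-Reasoning

    p∤k⇒h∈⟨hᵏ⟩ : ∀ {k} → ¬ p ∣ k → h ∈⟨ h ^ᴳ k ⟩
    p∤k⇒h∈⟨hᵏ⟩ {k} p∤k =
      exponent≤⇒∈⟨⟩ (∈⟨⟩-refl h) (k , refl) (subst (_≤ exponent (h ^ᴳ k)) (sym (exponent-of-order oʰ)) 1+s≤)
      where
      1+s≤ : suc s ≤ exponent (h ^ᴳ k)
      1+s≤ with ≤-<-connex (suc s) (exponent (h ^ᴳ k))
      ... | inj₁ ≤ = ≤
      ... | inj₂ (s≤s <) = ⊥-elim (p∤k (*-cancelʳ-∣ (p ^ s) {{m^n≢0 p s}} (^ᴳ≡e⇒order∣ oʰ (begin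
        h ^ᴳ (k * p ^ s)       ≡⟨ ^ᴳ-* h k (p ^ s) ⟩
        (h ^ᴳ k) ^ᴳ (p ^ s)    ≡⟨ order∣⇒^ᴳ≡e (order-exponent _) (≤⇒p^∣p^ <) ⟩
        e                      ∎))))
        where open ≡-Reasoning

    -- |[h]| = φ(p^{s+1}): the map k ↦ h^k from Fin p^{s+1} hits [h] exactly at the k prime to p.
    class-size : ♯ [ h ] + p ^ s ≡ p ^ suc s
    class-size = begin
      ♯ [ h ] + p ^ s      ≡⟨ cong₂ _+_ class≡coprime (sym (♯-multiples p (p ^ s))) ⟩
      ♯ (not ∘ D) + ♯ D    ≡⟨ ♯-not D ⟩
      p ^ suc s            ∎
      where
      open ≡-Reasoning
      instance
        p^[1+s]≢0 : NonZero (p ^ suc s)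
        p^[1+s]≢0 = m^n≢0 p (suc s)
      D : Fin (p ^ suc s) → Bool
      D k = does (p ∣? toℕ k)
      hᵏ : Fin (p ^ suc s) → Fin card
      hᵏ k = h ^ᴳ toℕ k
      hᵏ-injective : ∀ i j → hᵏ i ≡ hᵏ j → i ≡ j
      hᵏ-injective i j eq with <-cmp (toℕ i) (toℕ j)
      ... | tri< i<j _ _ = ⊥-elim (^ᴳ-injective-below-order oʰ i<j (toℕ<n j) eq)
      ... | tri≈ _ i≡j _ = toℕ-injective i≡j
      ... | tri> _ _ j<i = ⊥-elim (^ᴳ-injective-below-order oʰ j<i (toℕ<n i) (sym eq))
      generator : ∀ k → T (not (D k)) → T (sameCyc G (hᵏ k) h)
      generator k t = ⇒sameCyc (toℕ k , refl) (p∤k⇒h∈⟨hᵏ⟩ (T-not-does⇒ (p ∣? toℕ k) t))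
      onto : ∀ w → T (sameCyc G w h) → ∃ λ k → hᵏ k ≡ w × T (not (D k))
      onto w t with sameCyc⇒ t
      ... | (j , hʲ≡w) , h∈⟨w⟩ = k , hᵏ≡w , ⇒T-not-does (p ∣? toℕ k) λ p∣k →
              <⇒≱ (n<1+n s) (≤-trans (subst (_≤ exponent w) (exponent-of-order oʰ) (exponent-mono h∈⟨w⟩))
                                  (subst (λ x → exponent x ≤ s) hᵏ≡w (p∣k⇒exponent≤ p∣k)))
        where
        k : Fin (p ^ suc s)
        k = fromℕ< (m%n<n j (p ^ suc s))
        hᵏ≡w : hᵏ k ≡ w
        hᵏ≡w = trans (cong (h ^ᴳ_) (toℕ-fromℕ< (m%n<n j (p ^ suc s)))) (trans (sym (^ᴳ-mod oʰ j)) hʲ≡w)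
      class≡coprime : ♯ [ h ] ≡ ♯ (not ∘ D)
      class≡coprime = ♯-injection hᵏ hᵏ-injective generator onto

    h∈U : T (inU G h h)
    h∈U = ∈⟨⟩⇒inCyc′ (∈⟨⟩-refl h)

    |U|-admissible : Admissible h s (♯ (inU G h))
    |U|-admissible = inj₂ (inj₂ (h , p ^ suc s , h∈U , oʰ , (begin
      ♯ (inU G h) + p ^ s
        ≡⟨ cong (_+ p ^ s) (♯-cong (U-split h)) ⟩
      ♯ (λ w → inUhat G h w ∨ sameCyc G w h) + p ^ s
        ≡⟨ cong (_+ p ^ s) (♯-∨ (inUhat G h) [ h ] Û∩[h]≡∅) ⟩
      ♯ (inUhat G h) + ♯ [ h ] + p ^ s
        ≡⟨ +-assoc (♯ (inUhat G h)) _ _ ⟩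
      ♯ (inUhat G h) + (♯ [ h ] + p ^ s)
        ≡⟨ cong₂ _+_ (sym (count≡♯ G (inUhat G h))) class-size ⟩
      Uhat-size G h + p ^ suc s ∎)))
      where
      open ≡-Reasoning
      Û∩[h]≡∅ : ∀ w → T (inUhat G h w) → ¬ T (sameCyc G w h)
      Û∩[h]≡∅ w w∈Û = ≡.subst T (Equivalence.to T-not-≡ (proj₂ (Equivalence.to T-∧ w∈Û)))

    class-size-+ : ∀ m → m + ♯ [ h ] + p ^ s ≡ m + p ^ suc s
    class-size-+ m = trans (+-assoc m _ (p ^ s)) (cong (m +_) class-size)

    admissible-lift : ∀ {h′ m′} → h ∈⟨ h′ ⟩ → Admissible h′ (suc s) m′ →
      Admissible h s (m′ + ♯ [ h ])
    admissible-lift h∈⟨h′⟩ (inj₁ refl) = inj₂ (inj₁ (h , p ^ suc s , h∈U , oʰ , class-size))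
    admissible-lift h∈⟨h′⟩ (inj₂ (inj₁ (g₁ , k , g₁∈U′ , o , eq))) =
      inj₂ (inj₁ (g₁ , k , inU-trans h∈⟨h′⟩ g₁∈U′ , o , trans (class-size-+ _) eq))
    admissible-lift h∈⟨h′⟩ (inj₂ (inj₂ (g₂ , k , g₂∈U′ , o , eq))) =
      inj₂ (inj₂ (g₂ , k , inU-trans h∈⟨h′⟩ g₂∈U′ , o , trans (class-size-+ _) eq))

module LaplacianSpectrum {c ℓ : Level} (R : CommutativeRing c ℓ) (domain : IsDomainChar0 R)
  (G : FinGroup) (p : ℕ) (1<p : 1 < p) (isPGroup : ∀ g → ∃ λ m → IsOrder G g (p ^ m)) where
  import Data.Nat as ℕ
  import Data.Nat.Properties as ℕₚ
  open CommutativeRing R hiding (zero)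
  open import Algebra.Properties.Ring ring using (-0#≈0#)
  open import Algebra.Properties.Group +-group using (//-rightDividesˡ; x∙y⁻¹≈ε⇒x≈y)
  open import Relation.Binary.Reasoning.Setoid setoid
  open RingSums R
  open Counting using (♯; count≡♯)
  open FinGroup G using (card; e)
  open FinGroupProperties G using (_∈⟨_⟩; inCyc⇒∈⟨⟩; adj-sym; order≤card)
  open PGroupProperties G p 1<p isPGroup

  Γ-adj : Fin card → Fin card → Fin card → Bool
  Γ-adj h u w = inU G h w ∧ adj G u w

  module Eigenvector {h μ} (v : Fin card → Carrier)
    (v-vanishes : ∀ u → T (not (inU G h u)) → v u ≈ 0#)
    (Lv≈μv : ∀ u → T (inU G h u) →
       ℕ→R R (count G (Γ-adj h u)) * v u - sumR R (λ w → if Γ-adj h u w then v w else 0#) ≈ μ * v u) where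

    F : Fin card → Fin card → Carrier
    F u w = if inU G h u ∧ Γ-adj h u w then v u - v w else 0#

    μv≈∑F : ∀ u → μ * v u ≈ sum (F u)
    μv≈∑F u with inU G h u in u∈U
    ... | true = sym (begin
      sum (λ w → if Γ-adj h u w then v u - v w else 0#)
        ≈⟨ ∑-if-diff (Γ-adj h u) (v u) v ⟩
      ℕ→R R (♯ (Γ-adj h u)) * v u - sum (λ w → if Γ-adj h u w then v w else 0#)
        ≈⟨ +-cong (*-congʳ (≡⇒≈ (≡.cong (ℕ→R R) (≡.sym (count≡♯ G (Γ-adj h u))))))
                  (-‿cong (≡⇒≈ (≡.sym (sumR≡sum (λ w → if Γ-adj h u w then v w else 0#))))) ⟩
      ℕ→R R (count G (Γ-adj h u)) * v u - sumR R (λ w → if Γ-adj h u w then v w else 0#)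
        ≈⟨ Lv≈μv u (≡.subst T (≡.sym u∈U) _) ⟩
      μ * v u ∎)
    ... | false = begin
      μ * v u         ≈⟨ *-congˡ (v-vanishes u (≡.subst (T ∘ not) (≡.sym u∈U) _)) ⟩
      μ * 0#          ≈⟨ zeroʳ μ ⟩
      0#              ≈⟨ sum-replicate-zero card ⟨
      sum {card} (λ _ → 0#) ∎

    F-antisymmetric : ∀ u w → F u w + F w u ≈ 0#
    F-antisymmetric u w with inU G h u | inU G h w | adj G u w | adj G w u | adj-sym u w
    ... | true  | true  | true  | .true  | ≡.refl = [x-y]+[y-x]≈0 (v u) (v w)
    ... | true  | true  | false | .false | ≡.refl = +-identityˡ 0#
    ... | true  | false | _     | _      | _      = +-identityˡ 0#
    ... | false | true  | _     | _      | _      = +-identityˡ 0#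
    ... | false | false | _     | _      | _      = +-identityˡ 0#

    -- Each edge contributes F u w + F w u = 0 to Σᵤ (L v)(u), and 2 ≠ 0 in R.
    μ∑v≈0 : μ * sum v ≈ 0#
    μ∑v≈0 = begin
      μ * sum v                ≈⟨ *-distribˡ-sum μ v ⟩
      sum (λ u → μ * v u)      ≈⟨ sum-cong-≋ μv≈∑F ⟩
      sum (λ u → sum (F u))    ≈⟨ x+x≈0⇒x≈0 domain _ (∑∑-antisymmetric F F-antisymmetric) ⟩
      0#                       ∎

    -- A vertex c ∈ [h] is adjacent to every other vertex of Γ(h).
    F-on-class : h ≢ e → ∀ {c} → T (sameCyc G c h) → ∀ w → F c w ≈ (if inU G h w then v c - v w else 0#)
    F-on-class h≢e {c} c∈[h] w = by-cases (c ≟ᶠ w)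
      where
      c∈U : T (inU G h c)
      c∈U = ∈⟨⟩⇒inCyc′ (proj₂ (sameCyc⇒ c∈[h]))
      x-x-if : ∀ b → (if b then v c - v c else 0#) ≈ 0#
      x-x-if true  = -‿inverseʳ (v c)
      x-x-if false = refl
      by-cases : Dec (c ≡ w) → F c w ≈ (if inU G h w then v c - v w else 0#)
      by-cases (yes ≡.refl) = trans (x-x-if _) (sym (x-x-if _))
      by-cases (no c≢w) = ≡⇒≈ (≡.cong (λ b → if b then v c - v w else 0#) (T-ext
        (λ t → proj₁ (Equivalence.to T-∧ (proj₂ (Equivalence.to (T-∧ {inU G h c}) t))))
        (λ w∈U → Equivalence.from T-∧ (c∈U , Equivalence.from T-∧ (w∈U , class-adjacent h≢e c∈[h] w∈U c≢w)))))

    μv≈|U|v-∑v : h ≢ e → ∀ {c} → T (sameCyc G c h) → μ * v c ≈ ℕ→R R (♯ (inU G h)) * v c - sum v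
    μv≈|U|v-∑v h≢e {c} c∈[h] = begin
      μ * v c                                                           ≈⟨ μv≈∑F c ⟩
      sum (F c)                                                         ≈⟨ sum-cong-≋ (F-on-class h≢e c∈[h]) ⟩
      sum (λ w → if inU G h w then v c - v w else 0#)                   ≈⟨ ∑-if-diff (inU G h) (v c) v ⟩
      ℕ→R R (♯ (inU G h)) * v c - sum (λ w → if inU G h w then v w else 0#)
                                                                        ≈⟨ +-congˡ (-‿cong (sum-cong-≋ v-on-U)) ⟩
      ℕ→R R (♯ (inU G h)) * v c - sum v                                 ∎
      where
      v-on-U : ∀ w → (if inU G h w then v w else 0#) ≈ v w
      v-on-U w with inU G h w in w∈U
      ... | true  = refl
      ... | false = sym (v-vanishes w (≡.subst (T ∘ not) (≡.sym w∈U) _))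

    module _ (v-class≈0 : ∀ c → T (sameCyc G c h) → v c ≈ 0#) {h′ s}
             (oʰ : IsOrder G h (p ^ suc s)) (oʰ′ : IsOrder G h′ (p ^ suc (suc s))) (h∈⟨h′⟩ : h ∈⟨ h′ ⟩) where

      v′ : Fin card → Carrier
      v′ w = if inU G h′ w then v w else 0#

      v′≈v : ∀ {w} → T (inU G h′ w) → v′ w ≈ v w
      v′≈v {w} w∈U′ with inU G h′ w
      ... | true = refl

      [h]-disjoint : ∀ d w → T (sameCyc G w h) → ¬ T (Γ-adj h′ d w)
      [h]-disjoint d w w∈[h] t = class∉U {s = s} oʰ oʰ′ h∈⟨h′⟩ w w∈[h] (proj₁ (Equivalence.to T-∧ t))

      neighbour-count : ∀ {d} → h′ ∈⟨ d ⟩ → count G (Γ-adj h d) ≡ ♯ [ h ] ℕ.+ ♯ (Γ-adj h′ d)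
      neighbour-count {d} h′∈⟨d⟩ = ≡.trans (count≡♯ G (Γ-adj h d))
        (≡.trans (Counting.♯-cong (neighbours-split {s = s} oʰ oʰ′ h∈⟨h′⟩ h′∈⟨d⟩))
                 (Counting.♯-∨ [ h ] (Γ-adj h′ d) ([h]-disjoint d)))

      neighbour-sum : ∀ {d} → h′ ∈⟨ d ⟩ →
        sumR R (λ w → if Γ-adj h d w then v w else 0#) ≈ sumR R (λ w → if Γ-adj h′ d w then v′ w else 0#)
      neighbour-sum {d} h′∈⟨d⟩ = begin
        sumR R (λ w → if Γ-adj h d w then v w else 0#)          ≡⟨ sumR≡sum (λ w → if Γ-adj h d w then v w else 0#) ⟩
        sum (λ w → if Γ-adj h d w then v w else 0#)
          ≈⟨ sum-cong-≋ (λ w → ≡⇒≈ (≡.cong (λ b → if b then v w else 0#) (neighbours-split {s = s} oʰ oʰ′ h∈⟨h′⟩ h′∈⟨d⟩ w))) ⟩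
        sum (λ w → if sameCyc G w h ∨ Γ-adj h′ d w then v w else 0#)
          ≈⟨ ∑-if-∨ [ h ] (Γ-adj h′ d) v ([h]-disjoint d) ⟩
        sum (λ w → if sameCyc G w h then v w else 0#) + sum (λ w → if Γ-adj h′ d w then v w else 0#)
          ≈⟨ +-cong (∑-if-zero [ h ] v v-class≈0) (sum-cong-≋ on-U′) ⟩
        0# + sum (λ w → if Γ-adj h′ d w then v′ w else 0#)      ≈⟨ +-identityˡ _ ⟩
        sum (λ w → if Γ-adj h′ d w then v′ w else 0#)          ≡⟨ sumR≡sum (λ w → if Γ-adj h′ d w then v′ w else 0#) ⟨
        sumR R (λ w → if Γ-adj h′ d w then v′ w else 0#)       ∎
        where
        on-U′ : ∀ w → (if Γ-adj h′ d w then v w else 0#) ≈ (if Γ-adj h′ d w then v′ w else 0#)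
        on-U′ w with Γ-adj h′ d w in t
        ... | true  = sym (v′≈v (proj₁ (Equivalence.to T-∧ (≡.subst T (≡.sym t) _))))
        ... | false = refl

      restricted-eigenvalue : ∀ u₀ → T (inU G h′ u₀) → ¬ v u₀ ≈ 0# →
        IsLapEigenvalueΓ R G h′ (μ - ℕ→R R (♯ [ h ]))
      restricted-eigenvalue u₀ u₀∈U′ vu₀≉0 =
        v′ , v′-vanishes , (u₀ , u₀∈U′ , λ v′u₀≈0 → vu₀≉0 (trans (sym (v′≈v u₀∈U′)) v′u₀≈0)) , Lv′≈μ′v′
        where
        v′-vanishes : ∀ u → T (not (inU G h′ u)) → v′ u ≈ 0#
        v′-vanishes u u∉U′ with inU G h′ u
        ... | false = refl
        Lv′≈μ′v′ : ∀ d → T (inU G h′ d) →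
          ℕ→R R (count G (Γ-adj h′ d)) * v′ d - sumR R (λ w → if Γ-adj h′ d w then v′ w else 0#)
            ≈ (μ - ℕ→R R (♯ [ h ])) * v′ d
        Lv′≈μ′v′ d d∈U′ = begin
          ℕ→R R (count G (Γ-adj h′ d)) * v′ d - S′
            ≈⟨ +-congʳ (*-cong (≡⇒≈ (≡.cong (ℕ→R R) (count≡♯ G (Γ-adj h′ d)))) (v′≈v d∈U′)) ⟩
          ℕ→R R (♯ (Γ-adj h′ d)) * v d - S′
            ≈⟨ [a+b]x-y≈zx⇒bx-y≈[z-a]x (ℕ→R R (♯ [ h ])) _ (v d) S′ μ Lv≈μv-at-d ⟩
          (μ - ℕ→R R (♯ [ h ])) * v d
            ≈⟨ *-congˡ (v′≈v d∈U′) ⟨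
          (μ - ℕ→R R (♯ [ h ])) * v′ d  ∎
          where
          S′ : Carrier
          S′ = sumR R (λ w → if Γ-adj h′ d w then v′ w else 0#)
          h′∈⟨d⟩ : h′ ∈⟨ d ⟩
          h′∈⟨d⟩ = inCyc⇒∈⟨⟩ d∈U′
          Lv≈μv-at-d : (ℕ→R R (♯ [ h ]) + ℕ→R R (♯ (Γ-adj h′ d))) * v d - S′ ≈ μ * v d
          Lv≈μv-at-d = begin
            (ℕ→R R (♯ [ h ]) + ℕ→R R (♯ (Γ-adj h′ d))) * v d - S′
              ≈⟨ +-cong (*-congʳ (ℕ→R-+ (♯ [ h ]) (♯ (Γ-adj h′ d)))) (-‿cong (neighbour-sum h′∈⟨d⟩)) ⟨
            ℕ→R R (♯ [ h ] ℕ.+ ♯ (Γ-adj h′ d)) * v d - sumR R (λ w → if Γ-adj h d w then v w else 0#)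
              ≡⟨ ≡.cong (λ n → ℕ→R R n * v d - sumR R (λ w → if Γ-adj h d w then v w else 0#))
                        (neighbour-count h′∈⟨d⟩) ⟨
            ℕ→R R (count G (Γ-adj h d)) * v d - sumR R (λ w → if Γ-adj h d w then v w else 0#)
              ≈⟨ Lv≈μv d (inU-trans h∈⟨h′⟩ d∈U′) ⟩
            μ * v d ∎

  -- n is fuel: each recursive step multiplies o(h) by p, and o(h) ≤ |G|.
  eigenvalue-admissible : ∀ n {h s} → card < p ^ suc s ℕ.+ n → IsOrder G h (p ^ suc s) →
    ∀ {μ} → IsLapEigenvalueΓ R G h μ → ∃ λ m → μ ≈ ℕ→R R m × Admissible h s m
  eigenvalue-admissible zero {s = s} card< oʰ _ =
    ⊥-elim (ℕₚ.<⇒≱ (≡.subst (card <_) (ℕₚ.+-identityʳ (p ^ suc s)) card<) (order≤card oʰ))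
  eigenvalue-admissible (suc n) {h} {s} card< oʰ {μ} (v , v-vanishes , (u₀ , u₀∈U , vu₀≉0) , Lv≈μv) =
    by-cases (proj₁ domain μ (sum v) μ∑v≈0)
    where
    open Eigenvector v v-vanishes Lv≈μv
    |U| |[h]| : ℕ
    |U|   = ♯ (inU G h)
    |[h]| = ♯ [ h ]

    h≢e : h ≢ e
    h≢e = order-p^[1+s]⇒≢e {s = s} oʰ

    class-dichotomy : sum v ≈ 0# → ∀ c → μ ≈ ℕ→R R |U| ⊎ (T (sameCyc G c h) → v c ≈ 0#)
    class-dichotomy ∑v≈0 c with sameCyc G c h in c∈[h]
    ... | false = inj₂ λ ()
    ... | true with proj₁ domain (μ - ℕ→R R |U|) (v c) (x*z≈y*z⇒[x-y]*z≈0 μ _ (v c) (begin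
          μ * v c                          ≈⟨ μv≈|U|v-∑v h≢e {c} (≡.subst T (≡.sym c∈[h]) _) ⟩
          ℕ→R R |U| * v c - sum v          ≈⟨ +-congˡ (trans (-‿cong ∑v≈0) -0#≈0#) ⟩
          ℕ→R R |U| * v c + 0#             ≈⟨ +-identityʳ _ ⟩
          ℕ→R R |U| * v c                  ∎))
    ...   | inj₁ μ-|U|≈0 = inj₁ (x∙y⁻¹≈ε⇒x≈y μ (ℕ→R R |U|) μ-|U|≈0)
    ...   | inj₂ vc≈0    = inj₂ λ _ → vc≈0

    fuel : card < p ^ suc (suc s) ℕ.+ n
    fuel = ℕₚ.<-≤-trans card< (≡.subst (ℕ._≤ p ^ suc (suc s) ℕ.+ n) (≡.sym (ℕₚ.+-suc (p ^ suc s) n))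
             (ℕₚ.+-monoˡ-< n (ℕₚ.^-monoʳ-< p 1<p (ℕₚ.n<1+n (suc s)))))

    climb : (∀ c → T (sameCyc G c h) → v c ≈ 0#) → ∃ λ m → μ ≈ ℕ→R R m × Admissible h s m
    climb v-class≈0 with ∃-cover-in {s = s} oʰ h∈⟨u₀⟩ u₀∉⟨h⟩
      where
      h∈⟨u₀⟩ : h ∈⟨ u₀ ⟩
      h∈⟨u₀⟩ = inCyc⇒∈⟨⟩ u₀∈U
      u₀∉⟨h⟩ : ¬ u₀ ∈⟨ h ⟩
      u₀∉⟨h⟩ u₀∈⟨h⟩ = vu₀≉0 (v-class≈0 u₀ (⇒sameCyc u₀∈⟨h⟩ h∈⟨u₀⟩))
    ... | h′ , oʰ′ , h∈⟨h′⟩ , h′∈⟨u₀⟩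
      with eigenvalue-admissible n {s = suc s} fuel oʰ′
             (restricted-eigenvalue v-class≈0 {s = s} oʰ oʰ′ h∈⟨h′⟩ u₀ (∈⟨⟩⇒inCyc′ h′∈⟨u₀⟩) vu₀≉0)
    ...   | m′ , μ′≈m′ , admissible = m′ ℕ.+ |[h]| , μ≈ , admissible-lift {s = s} oʰ h∈⟨h′⟩ admissible
      where
      μ≈ : μ ≈ ℕ→R R (m′ ℕ.+ |[h]|)
      μ≈ = begin
        μ                                         ≈⟨ //-rightDividesˡ (ℕ→R R |[h]|) μ ⟨
        (μ - ℕ→R R |[h]|) + ℕ→R R |[h]|          ≈⟨ +-congʳ μ′≈m′ ⟩
        ℕ→R R m′ + ℕ→R R |[h]|                   ≈⟨ ℕ→R-+ m′ |[h]| ⟨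
        ℕ→R R (m′ ℕ.+ |[h]|)                      ∎

    by-cases : μ ≈ 0# ⊎ sum v ≈ 0# → ∃ λ m → μ ≈ ℕ→R R m × Admissible h s m
    by-cases (inj₁ μ≈0)  = 0 , μ≈0 , inj₁ ≡.refl
    by-cases (inj₂ ∑v≈0) with ∀⊎⇒⊎∀ (class-dichotomy ∑v≈0)
    ... | inj₁ μ≈|U|     = |U| , μ≈|U| , |U|-admissible {s = s} oʰ
    ... | inj₂ v-class≈0 = climb v-class≈0

open import Data.Nat using (_+_; _∸_; _≤_; z≤n; s≤s; nonTrivial⇒n>1)
open import Data.Nat.Properties using (m<n+m; m^n>0)
open import Data.Nat.Primality using (Prime; prime⇒nonTrivial; prime⇒nonZero)

proposition3p21 : ∀ {c ℓ : Level} (p : ℕ) → Prime p → (G : FinGroup) → IsPGroup G p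
    → (g : Fin (FinGroup.card G)) (r : ℕ) → 1 ≤ r → IsOrder G g (p ^ r)
    → (0 < πcl G p g) ⊎ (2 < p ^ r)
    → (R : CommutativeRing c ℓ) → IsDomainChar0 R
    → (λ′ : CommutativeRing.Carrier R) → ¬ (CommutativeRing._≈_ R λ′ (CommutativeRing.0# R))
    → IsLapEigenvalueΓ R G g λ′
    → (∃ λ g₁ → ∃ λ k → T (inU G g g₁) × IsOrder G g₁ k
          × CommutativeRing._≈_ R (CommutativeRing._+_ R λ′ (ℕ→R R (p ^ (r ∸ 1)))) (ℕ→R R k))
      ⊎ (∃ λ g₂ → ∃ λ k → T (inU G g g₂) × IsOrder G g₂ k
          × CommutativeRing._≈_ R (CommutativeRing._+_ R λ′ (ℕ→R R (p ^ (r ∸ 1))))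
                                  (ℕ→R R (Uhat-size G g₂ + k)))
proposition3p21 p p-prime G (_ , isPGroup) g (suc s) (s≤s z≤n) oᵍ _ R domain λ′ λ′≉0 eigenvalue
  with LaplacianSpectrum.eigenvalue-admissible R domain G p (nonTrivial⇒n>1 p {{prime⇒nonTrivial p-prime}}) isPGroup
         card {g} {s} (m<n+m card (m^n>0 p {{prime⇒nonZero p-prime}} (suc s))) oᵍ eigenvalue
  where card = FinGroup.card G
... | m , λ′≈m , inj₁ ≡.refl = ⊥-elim (λ′≉0 λ′≈m)
... | m , λ′≈m , inj₂ (inj₁ (g₁ , k , g₁∈U , o , m+p^s≡k)) =
  inj₁ (g₁ , k , g₁∈U , o , RingSums.≈ℕ→R⇒+≈ℕ→R R m (p ^ s) λ′≈m m+p^s≡k)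
... | m , λ′≈m , inj₂ (inj₂ (g₂ , k , g₂∈U , o , m+p^s≡Û+k)) =
  inj₂ (g₂ , k , g₂∈U , o , RingSums.≈ℕ→R⇒+≈ℕ→R R m (p ^ s) λ′≈m m+p^s≡Û+k)
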